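{- Let $M$ be an accordion with partition $(G,F,H)$ where $F$ is a maximal fan having even length at least four, and $G$ is a left-hand fan-type end of $F$. Suppose that $F$ has ordering $(e_1,e_2,\ldots,e_{|F|})$, where $\{e_1,e_2,e_3\}$ is a triangle, and $G \cup \{e_1\}$ has ordering $(e_1,g_2,g_3,g_4,g_5)$. Then $\sqcap(\{g_2,g_4\}, H) = 1$, and $\sqcap^*(\{g_4,g_5\}, H) = 1$.
   Context: $M$ is a $3$-connected matroid with rank function $r$ and dual rank function $r^*$. The local connectivity of $X,Y\subseteq E(M)$ is $\sqcap(X,Y)=r(X)+r(Y)-r(X\cup Y)$, and $\sqcap^*(X,Y)=r^*(X)+r^*(Y)-r^*(X\cup Y)$ is the local connectivity in the dual $M^*$. A triangle is a $3$-element circuit, a triad a $3$-element cocircuit, and a quad a $4$-element set that is both a circuit and a cocircuit. A fan is a set $F$ with $|F|\ge 3$ and an ordering $(e_1,\dots,e_{|F|})$ such that $\{e_1,e_2,e_3\}$ is a triangle or triad and, for each $i$, if $\{e_i,e_{i+1},e_{i+2}\}$ is a triangle then $\{e_{i+1},e_{i+2},e_{i+3}\}$ is a triad and vice versa (also any $2$-element set is a fan); a fan is maximal if it is not properly contained in another fan. Let $F=(e_1,\dots,e_{|F|})$ be a maximal fan of $M$ of even length at least four with $\{e_1,e_2,e_3\}$ a triangle, and let $X\subseteq E(M)-F$ with $|E(M)|\ge |X\cup F|+2$. $X$ is a left-hand fan-type end of $F$ if $X\cup\{e_1\}$ is a maximal fan of length five with ordering $(e_1,g_2,g_3,g_4,g_5)$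 such that $\{e_1,g_2,g_3\}$ is a triangle and $\{e_1,e_2,g_3,g_5\}$ is a cocircuit. $X$ is a left-hand quad-type end if $X=\{a_1,a_2,b_1,b_2\}$ is a quad such that $\{e_1,a_1,a_2\}$ and $\{e_1,b_1,b_2\}$ are triangles, each not contained in a $4$-element fan, and $\{e_1,e_2,a_1,b_1\}$, $\{e_1,e_2,a_2,b_2\}$ are cocircuits. $X$ is a left-hand triangle-type end if $X\cup\{e_1\}$ is a triangle not contained in a $4$-element fan and $X\cup\{e_1,e_2\}$ is a cocircuit. $X$ is a right-hand fan-type end of $F$ if $X\cup\{e_{|F|}\}$ is a maximal fan of length five with ordering $(e_{|F|},h_2,h_3,h_4,h_5)$ such that $\{e_{|F|},h_2,h_3\}$ is a triad and $\{e_{|F|-1},e_{|F|},h_3,h_5\}$ is a circuit. $X$ is a right-hand quad-type end if $X=\{c_1,c_2,d_1,d_2\}$ is a quad such that $\{e_{|F|},c_1,c_2\}$ and $\{e_{|F|},d_1,d_2\}$ are triads, each not contained in a $4$-element fan, and $\{e_{|F|-1},e_{|F|},c_1,d_1\}$, $\{e_{|F|-1},e_{|F|},c_2,d_2\}$ are circuits. $X$ is a right-hand triad-type end if $X\cup\{e_{|F|}\}$ is a triad not contained in a $4$-element fan and $X\cup\{e_{|F|-1},e_{|F|}\}$ is a circuit. $M$ is an accordion with partition $(G,F,H)$ if $(G,F,H)$ partitions $E(M)$, $F$ is a maximal fan of even length at least four, $G$ is a left-hand fan-type, quad-type, or triangle-type end of $F$, and $H$ is a right-hand fan-type, quad-type,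 or triad-type end of $F$. -}

module Defs where

open import Data.Nat using (ℕ; zero; suc; _+_; _*_; _∸_; _≤_; _<_)
open import Data.Fin using (Fin)
open import Data.Fin.Subset
  using (Subset; ⁅_⁆; _∈_; _⊆_; _⊂_; ∁; _∩_; _∪_; ∣_∣)
  renaming (⊥ to ∅; ⊤ to Full)
open import Data.List using (List; []; _∷_; length)
open import Data.List.Relation.Unary.Unique.Propositional using (Unique)
open import Data.Vec using (Vec; head; tail; last; init; toList)
open import Data.Product using (Σ; ∃; ∃-syntax; _×_; _,_)
open import Data.Sum using (_⊎_)
open import Data.Unit using (⊤)
open import Relation.Nullary using (¬_)
open import Relation.Binary.PropositionalEquality using (_≡_)

record Matroid (n : ℕ) : Set where
  field
    r       : Subset n → ℕ
    r-bound : ∀ X → r X ≤ ∣ X ∣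
    r-mono  : ∀ X Y → X ⊆ Y → r X ≤ r Y
    r-submod : ∀ X Y → r (X ∪ Y) + r (X ∩ Y) ≤ r X + r Y

open Matroid public

module _ {n : ℕ} where

  E : Subset n
  E = Full

  -- dual rank: r*(X) = |X| + r(E - X) - r(E)
  -- (truncated subtraction is exact here since r(E) ≤ r(E - X) + |X|)
  r* : Matroid n → Subset n → ℕ
  r* M X = ∣ X ∣ + r M (∁ X) ∸ r M E

  -- local connectivity with respect to a rank function
  -- (exact, since rk(X ∪ Y) ≤ rk X + rk Y)
  ⊓[_] : (Subset n → ℕ) → Subset n → Subset n → ℕ
  ⊓[ rk ] X Y = rk X + rk Y ∸ rk (X ∪ Y)

  ⊓ : Matroid n → Subset n → Subset n → ℕ
  ⊓ M = ⊓[ r M ]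

  ⊓* : Matroid n → Subset n → Subset n → ℕ
  ⊓* M = ⊓[ r* M ]

  Independent : (Subset n → ℕ) → Subset n → Set
  Independent rk X = rk X ≡ ∣ X ∣

  Dependent : (Subset n → ℕ) → Subset n → Set
  Dependent rk X = rk X < ∣ X ∣

  IsCircuitR : (Subset n → ℕ) → Subset n → Set
  IsCircuitR rk X = Dependent rk X × (∀ Y → Y ⊂ X → Independent rk Y)

  IsCircuit : Matroid n → Subset n → Set
  IsCircuit M = IsCircuitR (r M)

  IsCocircuit : Matroid n → Subset n → Set
  IsCocircuit M = IsCircuitR (r* M)

  IsTriangle : Matroid n → Subset n → Set
  IsTriangle M X = IsCircuit M X × ∣ X ∣ ≡ 3

  IsTriad : Matroid n → Subset n → Set
  IsTriad M X = IsCocircuit M X × ∣ X ∣ ≡ 3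

  IsQuad : Matroid n → Subset n → Set
  IsQuad M X = IsCircuit M X × IsCocircuit M X × ∣ X ∣ ≡ 4

  -- 3-connectivity: no k-separation for k < 3, where a k-separation is
  -- a partition (X, E - X) with |X|, |E - X| ≥ k and
  -- r(X) + r(E - X) - r(M) ≤ k - 1.
  ThreeConnected : Matroid n → Set
  ThreeConnected M = ∀ (X : Subset n) (k : ℕ) → k < 3 → k ≤ ∣ X ∣ → k ≤ ∣ ∁ X ∣ →
    ¬ (r M X + r M (∁ X) < k + r M E)

  setOf : List (Fin n) → Subset n
  setOf []       = ∅
  setOf (x ∷ xs) = ⁅ x ⁆ ∪ setOf xs

  ⟅_,_,_⟆ : Fin n → Fin n → Fin n → Subset n
  ⟅ a , b , c ⟆ = setOf (a ∷ b ∷ c ∷ [])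

  Alternates : Matroid n → List (Fin n) → Set
  Alternates M (a ∷ b ∷ c ∷ d ∷ rest) =
    (IsTriangle M ⟅ a , b , c ⟆ → IsTriad M ⟅ b , c , d ⟆) ×
    (IsTriad M ⟅ a , b , c ⟆ → IsTriangle M ⟅ b , c , d ⟆) ×
    Alternates M (b ∷ c ∷ d ∷ rest)
  Alternates M _ = ⊤

  FirstTriple : Matroid n → List (Fin n) → Set
  FirstTriple M (a ∷ b ∷ c ∷ _) = IsTriangle M ⟅ a , b , c ⟆ ⊎ IsTriad M ⟅ a , b , c ⟆
  FirstTriple M _ = ⊤

  IsFanOrdering : Matroid n → List (Fin n) → Set
  IsFanOrdering M es = Unique es × 3 ≤ length es × FirstTriple M es × Alternates M es

  IsFan : Matroid n → Subset n → Set
  IsFan M F = ∣ F ∣ ≡ 2 ⊎ (∃[ es ] (IsFanOrdering M es × setOf es ≡ F))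

  IsMaximalFan : Matroid n → Subset n → Set
  IsMaximalFan M F = IsFan M F × (∀ F′ → IsFan M F′ → ¬ (F ⊂ F′))

  InFourFan : Matroid n → Subset n → Set
  InFourFan M T = ∃[ F′ ] (IsFan M F′ × ∣ F′ ∣ ≡ 4 × T ⊆ F′)

  Disjoint : Subset n → Subset n → Set
  Disjoint X Y = X ∩ Y ≡ ∅

  -- Ends of a maximal fan F with ordering (e₁, e₂, …, e_{|F|-1}, e_{|F|}),
  -- described by its set F, the first two elements e₁ e₂ and the last
  -- two elements eₗ₋₁ eₗ.
  EndBase : Subset n → Subset n → Set
  EndBase F X = Disjoint X F × ∣ X ∪ F ∣ + 2 ≤ n

  LeftFanTypeEndWith : Matroid n → (F : Subset n) → (e₁ e₂ : Fin n) → Subset n →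
                       (g₂ g₃ g₄ g₅ : Fin n) → Set
  LeftFanTypeEndWith M F e₁ e₂ X g₂ g₃ g₄ g₅ =
    EndBase F X ×
    IsMaximalFan M (X ∪ ⁅ e₁ ⁆) ×
    ∣ X ∪ ⁅ e₁ ⁆ ∣ ≡ 5 ×
    IsFanOrdering M (e₁ ∷ g₂ ∷ g₃ ∷ g₄ ∷ g₅ ∷ []) ×
    setOf (e₁ ∷ g₂ ∷ g₃ ∷ g₄ ∷ g₅ ∷ []) ≡ X ∪ ⁅ e₁ ⁆ ×
    IsTriangle M ⟅ e₁ , g₂ , g₃ ⟆ ×
    IsCocircuit M (setOf (e₁ ∷ e₂ ∷ g₃ ∷ g₅ ∷ []))

  LeftFanTypeEnd : Matroid n → Subset n → Fin n → Fin n → Subset n → Set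
  LeftFanTypeEnd M F e₁ e₂ X =
    ∃[ g₂ ] ∃[ g₃ ] ∃[ g₄ ] ∃[ g₅ ] LeftFanTypeEndWith M F e₁ e₂ X g₂ g₃ g₄ g₅

  LeftQuadTypeEnd : Matroid n → Subset n → Fin n → Fin n → Subset n → Set
  LeftQuadTypeEnd M F e₁ e₂ X =
    EndBase F X ×
    ∃[ a₁ ] ∃[ a₂ ] ∃[ b₁ ] ∃[ b₂ ]
      ( Unique (a₁ ∷ a₂ ∷ b₁ ∷ b₂ ∷ [])
      × X ≡ setOf (a₁ ∷ a₂ ∷ b₁ ∷ b₂ ∷ [])
      × IsQuad M X
      × IsTriangle M ⟅ e₁ , a₁ , a₂ ⟆ × ¬ InFourFan M ⟅ e₁ , a₁ , a₂ ⟆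
      × IsTriangle M ⟅ e₁ , b₁ , b₂ ⟆ × ¬ InFourFan M ⟅ e₁ , b₁ , b₂ ⟆
      × IsCocircuit M (setOf (e₁ ∷ e₂ ∷ a₁ ∷ b₁ ∷ []))
      × IsCocircuit M (setOf (e₁ ∷ e₂ ∷ a₂ ∷ b₂ ∷ [])))

  LeftTriangleTypeEnd : Matroid n → Subset n → Fin n → Fin n → Subset n → Set
  LeftTriangleTypeEnd M F e₁ e₂ X =
    EndBase F X ×
    IsTriangle M (X ∪ ⁅ e₁ ⁆) × ¬ InFourFan M (X ∪ ⁅ e₁ ⁆) ×
    IsCocircuit M (X ∪ (⁅ e₁ ⁆ ∪ ⁅ e₂ ⁆))

  LeftEnd : Matroid n → Subset n → Fin n → Fin n → Subset n → Set
  LeftEnd M F e₁ e₂ X =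
    LeftFanTypeEnd M F e₁ e₂ X ⊎ LeftQuadTypeEnd M F e₁ e₂ X ⊎ LeftTriangleTypeEnd M F e₁ e₂ X

  RightFanTypeEnd : Matroid n → Subset n → Fin n → Fin n → Subset n → Set
  RightFanTypeEnd M F eₗ₋₁ eₗ X =
    EndBase F X ×
    ∃[ h₂ ] ∃[ h₃ ] ∃[ h₄ ] ∃[ h₅ ]
      ( IsMaximalFan M (X ∪ ⁅ eₗ ⁆)
      × ∣ X ∪ ⁅ eₗ ⁆ ∣ ≡ 5
      × IsFanOrdering M (eₗ ∷ h₂ ∷ h₃ ∷ h₄ ∷ h₅ ∷ [])
      × setOf (eₗ ∷ h₂ ∷ h₃ ∷ h₄ ∷ h₅ ∷ []) ≡ X ∪ ⁅ eₗ ⁆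
      × IsTriad M ⟅ eₗ , h₂ , h₃ ⟆
      × IsCircuit M (setOf (eₗ₋₁ ∷ eₗ ∷ h₃ ∷ h₅ ∷ [])))

  RightQuadTypeEnd : Matroid n → Subset n → Fin n → Fin n → Subset n → Set
  RightQuadTypeEnd M F eₗ₋₁ eₗ X =
    EndBase F X ×
    ∃[ c₁ ] ∃[ c₂ ] ∃[ d₁ ] ∃[ d₂ ]
      ( Unique (c₁ ∷ c₂ ∷ d₁ ∷ d₂ ∷ [])
      × X ≡ setOf (c₁ ∷ c₂ ∷ d₁ ∷ d₂ ∷ [])
      × IsQuad M X
      × IsTriad M ⟅ eₗ , c₁ , c₂ ⟆ × ¬ InFourFan M ⟅ eₗ , c₁ , c₂ ⟆
      × IsTriad M ⟅ eₗ , d₁ , d₂ ⟆ × ¬ InFourFan M ⟅ eₗ , d₁ , d₂ ⟆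
      × IsCircuit M (setOf (eₗ₋₁ ∷ eₗ ∷ c₁ ∷ d₁ ∷ []))
      × IsCircuit M (setOf (eₗ₋₁ ∷ eₗ ∷ c₂ ∷ d₂ ∷ [])))

  RightTriadTypeEnd : Matroid n → Subset n → Fin n → Fin n → Subset n → Set
  RightTriadTypeEnd M F eₗ₋₁ eₗ X =
    EndBase F X ×
    IsTriad M (X ∪ ⁅ eₗ ⁆) × ¬ InFourFan M (X ∪ ⁅ eₗ ⁆) ×
    IsCircuit M (X ∪ (⁅ eₗ₋₁ ⁆ ∪ ⁅ eₗ ⁆))

  RightEnd : Matroid n → Subset n → Fin n → Fin n → Subset n → Set
  RightEnd M F eₗ₋₁ eₗ X =
    RightFanTypeEnd M F eₗ₋₁ eₗ X ⊎ RightQuadTypeEnd M F eₗ₋₁ eₗ X ⊎ RightTriadTypeEnd M F eₗ₋₁ eₗ X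

  -- Accordions.  The fan F comes with an ordering es = (e₁,…,e_{|F|}),
  -- given as a vector of length k + 2, so e₁ = head es, e₂ = head (tail es),
  -- e_{|F|} = last es, e_{|F|-1} = last (init es).

  e-1 : ∀ {k} → Vec (Fin n) (suc (suc k)) → Fin n
  e-1 es = head es
  e-2 : ∀ {k} → Vec (Fin n) (suc (suc k)) → Fin n
  e-2 es = head (tail es)
  e-last : ∀ {k} → Vec (Fin n) (suc (suc k)) → Fin n
  e-last es = last es
  e-penult : ∀ {k} → Vec (Fin n) (suc (suc k)) → Fin n
  e-penult es = last (init es)

  IsEvenMaxFanOrdered : Matroid n → Subset n → ∀ {k} → Vec (Fin n) (suc (suc k)) → Set
  IsEvenMaxFanOrdered M F {k} es =
    IsMaximalFan M F ×
    IsFanOrdering M (toList es) ×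
    setOf (toList es) ≡ F ×
    (∃[ j ] (k ≡ suc j + suc j)) ×
    FirstTripleTriangle (toList es)
    where
      FirstTripleTriangle : List (Fin n) → Set
      FirstTripleTriangle (a ∷ b ∷ c ∷ _) = IsTriangle M ⟅ a , b , c ⟆
      FirstTripleTriangle _ = ⊤

  IsPartition3 : Subset n → Subset n → Subset n → Set
  IsPartition3 G F H = Disjoint G F × Disjoint G H × Disjoint F H × G ∪ (F ∪ H) ≡ E

  IsAccordionWith : Matroid n → Subset n → Subset n → Subset n →
                    ∀ {k} → Vec (Fin n) (suc (suc k)) → Set
  IsAccordionWith M G F H es =
    ThreeConnected M ×
    IsPartition3 G F H ×
    IsEvenMaxFanOrdered M F es ×
    LeftEnd M F (e-1 es) (e-2 es) G ×
    RightEnd M F (e-penult es) (e-last es) H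

-- Write λ(X) = r(X) + r(E - X) - r(M).  In a 3-connected matroid λ(X) ≥ 2 whenever X and
-- E - X both have two elements, while adding to X an element of its closure or coclosure
-- does not increase λ; hence every fan has λ ≤ 2.  Adding g₅ and then g₃ (coclosure, by
-- the cocircuit {e₁,e₂,g₃,g₅}) to F gives a set X with λ(X) ≤ 3 whose complement is
-- {g₂,g₄} ∪ H, and the two triangles put g₂ and g₄ in the closure of X, so r(E - H) = r(X).
-- Comparing λ(X) with λ(H) ≥ 2 yields r({g₂,g₄} ∪ H) ≤ r(H) + 1; the triad {g₂,g₃,g₄}
-- forces equality, and {g₂,g₄} is independent by 3-connectivity.  Dually, X = F ∪ {g₂,g₃}
-- has λ(X) ≤ 3 and complement {g₄,g₅} ∪ H; the cocircuit and the triad keep g₅ and then g₄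
-- out of the closure of H, which yields r(E - H) = r(X) + 1, the dual form of the claim.
module Submission where

open import Defs
open import Data.Nat using (ℕ; suc; _+_; _∸_; _≤_; _<_; z≤n; s≤s; _≤?_)
open import Data.Nat.Properties
open import Data.Fin using (Fin) renaming (_≟_ to _≟ᶠ_)
open import Data.Fin.Subset
  using (Subset; ⁅_⁆; _∪_; _∩_; _─_; _-_; ∁; _∈_; _∉_; _⊆_; ∣_∣; inside; outside)
  renaming (⊤ to Full)
open import Data.Fin.Subset.Properties
open import Data.Vec using (Vec; _∷_; []; toList; tail) renaming (here to hereᵛ; there to thereᵛ)
open import Data.List using (List; []; _∷_)
open import Data.List.Membership.Propositional using () renaming (_∈_ to _∈ˡ_)
open import Data.List.Relation.Unary.All as All using (All; []; _∷_)
open import Data.List.Relation.Unary.Any using (here; there)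
open import Data.List.Relation.Unary.AllPairs as AllPairs using (_∷_)
open import Data.List.Relation.Unary.Unique.Propositional using (Unique)
open import Data.Product using (_×_; _,_; proj₁; proj₂)
open import Data.Sum using (inj₁; inj₂)
open import Function using (_∘_)
open import Relation.Nullary using (¬_; yes; no; contradiction)
open import Relation.Binary.PropositionalEquality
  using (_≡_; _≢_; refl; sym; trans; cong; cong₂; subst; ≢-sym; module ≡-Reasoning)

∣p∪q∣≤∣p∣+∣q∣ : ∀ {n} (p q : Subset n) → ∣ p ∪ q ∣ ≤ ∣ p ∣ + ∣ q ∣
∣p∪q∣≤∣p∣+∣q∣ []            []            = z≤n
∣p∪q∣≤∣p∣+∣q∣ (inside  ∷ p) (inside  ∷ q) =
  s≤s (≤-trans (m≤n⇒m≤1+n (∣p∪q∣≤∣p∣+∣q∣ p q)) (≤-reflexive (sym (+-suc ∣ p ∣ ∣ q ∣))))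
∣p∪q∣≤∣p∣+∣q∣ (inside  ∷ p) (outside ∷ q) = s≤s (∣p∪q∣≤∣p∣+∣q∣ p q)
∣p∪q∣≤∣p∣+∣q∣ (outside ∷ p) (inside  ∷ q) =
  ≤-trans (s≤s (∣p∪q∣≤∣p∣+∣q∣ p q)) (≤-reflexive (sym (+-suc ∣ p ∣ ∣ q ∣)))
∣p∪q∣≤∣p∣+∣q∣ (outside ∷ p) (outside ∷ q) = ∣p∪q∣≤∣p∣+∣q∣ p q

∣p∪q∣≡∣p∣+∣q∣ : ∀ {n} (p q : Subset n) → Disjoint p q → ∣ p ∪ q ∣ ≡ ∣ p ∣ + ∣ q ∣
∣p∪q∣≡∣p∣+∣q∣ []            []            _  = refl
∣p∪q∣≡∣p∣+∣q∣ (inside  ∷ p) (inside  ∷ q) ()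
∣p∪q∣≡∣p∣+∣q∣ (inside  ∷ p) (outside ∷ q) pq = cong suc (∣p∪q∣≡∣p∣+∣q∣ p q (cong tail pq))
∣p∪q∣≡∣p∣+∣q∣ (outside ∷ p) (inside  ∷ q) pq =
  trans (cong suc (∣p∪q∣≡∣p∣+∣q∣ p q (cong tail pq))) (sym (+-suc ∣ p ∣ ∣ q ∣))
∣p∪q∣≡∣p∣+∣q∣ (outside ∷ p) (outside ∷ q) pq = ∣p∪q∣≡∣p∣+∣q∣ p q (cong tail pq)

x∈p─q⇒x∉q : ∀ {n x} (p q : Subset n) → x ∈ p ─ q → x ∉ q
x∈p─q⇒x∉q (_ ∷ p) (outside ∷ q) hereᵛ        ()
x∈p─q⇒x∉q (_ ∷ p) (_       ∷ q) (thereᵛ x∈) (thereᵛ x∈q) = x∈p─q⇒x∉q p q x∈ x∈q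

module _ {n : ℕ} where

  x∉p∪q⁺ : ∀ {x} {p q : Subset n} → x ∉ p → x ∉ q → x ∉ p ∪ q
  x∉p∪q⁺ {p = p} {q} x∉p x∉q x∈p∪q with x∈p∪q⁻ p q x∈p∪q
  ... | inj₁ x∈p = x∉p x∈p
  ... | inj₂ x∈q = x∉q x∈q

  ∪-least : ∀ {p q r : Subset n} → p ⊆ r → q ⊆ r → p ∪ q ⊆ r
  ∪-least {p} {q} p⊆r q⊆r x∈p∪q with x∈p∪q⁻ p q x∈p∪q
  ... | inj₁ x∈p = p⊆r x∈p
  ... | inj₂ x∈q = q⊆r x∈q

  x∈p∪⁅x⁆ : ∀ (p : Subset n) x → x ∈ p ∪ ⁅ x ⁆
  x∈p∪⁅x⁆ p x = q⊆p∪q p ⁅ x ⁆ (x∈⁅x⁆ x)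

  p⊆∁q⇒q⊆∁p : ∀ {p q : Subset n} → p ⊆ ∁ q → q ⊆ ∁ p
  p⊆∁q⇒q⊆∁p p⊆∁q x∈q = x∉p⇒x∈∁p λ x∈p → x∈∁p⇒x∉p (p⊆∁q x∈p) x∈q

  ∁q⊆r∪p⇒∁[p∪q]⊆r : ∀ {p q r : Subset n} → ∁ q ⊆ r ∪ p → ∁ (p ∪ q) ⊆ r
  ∁q⊆r∪p⇒∁[p∪q]⊆r {p} {q} {r} ∁q⊆r∪p x∈∁[p∪q]
    with x∈p∪q⁻ r p (∁q⊆r∪p (x∉p⇒x∈∁p (x∈∁p⇒x∉p x∈∁[p∪q] ∘ q⊆p∪q p q)))
  ... | inj₁ x∈r = x∈r
  ... | inj₂ x∈p = contradiction (p⊆p∪q q x∈p) (x∈∁p⇒x∉p x∈∁[p∪q])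

  x∈p⇒⁅x⁆⊆p : ∀ {x} {p : Subset n} → x ∈ p → ⁅ x ⁆ ⊆ p
  x∈p⇒⁅x⁆⊆p {x} {p} x∈p y∈⁅x⁆ = subst (_∈ p) (sym (x∈⁅y⁆⇒x≡y x y∈⁅x⁆)) x∈p

  p⊆p-x∪⁅x⁆ : ∀ (p : Subset n) x → p ⊆ (p - x) ∪ ⁅ x ⁆
  p⊆p-x∪⁅x⁆ p x {y} y∈p with y ≟ᶠ x
  ... | yes refl = q⊆p∪q (p - x) ⁅ x ⁆ (x∈⁅x⁆ x)
  ... | no  y≢x  = p⊆p∪q ⁅ x ⁆ (x∈p∧x≢y⇒x∈p-y y∈p y≢x)

  ∁[p-x]⊆∁p∪⁅x⁆ : ∀ (p : Subset n) x → ∁ (p - x) ⊆ ∁ p ∪ ⁅ x ⁆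
  ∁[p-x]⊆∁p∪⁅x⁆ p x {y} y∈∁[p-x] with y ≟ᶠ x
  ... | yes refl = q⊆p∪q (∁ p) ⁅ x ⁆ (x∈⁅x⁆ x)
  ... | no  y≢x  =
    p⊆p∪q ⁅ x ⁆ (x∉p⇒x∈∁p λ y∈p → x∈∁p⇒x∉p y∈∁[p-x] (x∈p∧x≢y⇒x∈p-y y∈p y≢x))

  ∁q⊆∁[p∪q]∪p : ∀ (p q : Subset n) → ∁ q ⊆ ∁ (p ∪ q) ∪ p
  ∁q⊆∁[p∪q]∪p p q {x} x∈∁q with x ∈? p
  ... | yes x∈p = q⊆p∪q (∁ (p ∪ q)) p x∈p
  ... | no  x∉p = p⊆p∪q p (x∉p⇒x∈∁p (x∉p∪q⁺ x∉p (x∈∁p⇒x∉p x∈∁q)))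

  disjoint⁺ : ∀ {p q : Subset n} → (∀ {x} → x ∈ p → x ∉ q) → Disjoint p q
  disjoint⁺ {p} {q} p∌q =
    Empty-unique λ (x , x∈p∩q) → let (x∈p , x∈q) = x∈p∩q⁻ p q x∈p∩q in p∌q x∈p x∈q

  disjoint⁻ : ∀ {p q : Subset n} {x} → Disjoint p q → x ∈ p → x ∉ q
  disjoint⁻ p∩q≡∅ x∈p x∈q = ∉⊥ (subst (_ ∈_) p∩q≡∅ (x∈p∩q⁺ (x∈p , x∈q)))

  ∣⁅x⁆∪⁅y⁆∣≡2 : ∀ {x y : Fin n} → x ≢ y → ∣ ⁅ x ⁆ ∪ ⁅ y ⁆ ∣ ≡ 2
  ∣⁅x⁆∪⁅y⁆∣≡2 {x} {y} x≢y = begin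
    ∣ ⁅ x ⁆ ∪ ⁅ y ⁆ ∣     ≡⟨ ∣p∪q∣≡∣p∣+∣q∣ ⁅ x ⁆ ⁅ y ⁆ (disjoint⁺ x∉⁅y⁆) ⟩
    ∣ ⁅ x ⁆ ∣ + ∣ ⁅ y ⁆ ∣ ≡⟨ cong₂ _+_ (∣⁅x⁆∣≡1 x) (∣⁅x⁆∣≡1 y) ⟩
    2                     ∎
    where
    open ≡-Reasoning
    x∉⁅y⁆ : ∀ {z} → z ∈ ⁅ x ⁆ → z ∉ ⁅ y ⁆
    x∉⁅y⁆ z∈⁅x⁆ = subst (_∉ ⁅ y ⁆) (sym (x∈⁅y⁆⇒x≡y x z∈⁅x⁆)) (x≢y⇒x∉⁅y⁆ x≢y)

  2≤∣p∣ : ∀ {x y : Fin n} {p : Subset n} → x ≢ y → x ∈ p → y ∈ p → 2 ≤ ∣ p ∣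
  2≤∣p∣ {p = p} x≢y x∈p y∈p =
    subst (_≤ ∣ p ∣) (∣⁅x⁆∪⁅y⁆∣≡2 x≢y) (p⊆q⇒∣p∣≤∣q∣ (∪-least (x∈p⇒⁅x⁆⊆p x∈p) (x∈p⇒⁅x⁆⊆p y∈p)))

  ∪≡⊤⇒n≤∣p∣+∣q∣ : ∀ {p q : Subset n} → p ∪ q ≡ Full → n ≤ ∣ p ∣ + ∣ q ∣
  ∪≡⊤⇒n≤∣p∣+∣q∣ {p} {q} p∪q≡⊤ =
    subst (_≤ ∣ p ∣ + ∣ q ∣) (trans (cong ∣_∣ p∪q≡⊤) (∣⊤∣≡n n)) (∣p∪q∣≤∣p∣+∣q∣ p q)

  ⁅⁆-∪-cancelˡ : ∀ {x} {p q : Subset n} → ⁅ x ⁆ ∪ p ≡ ⁅ x ⁆ ∪ q → x ∉ p → x ∉ q → p ≡ q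
  ⁅⁆-∪-cancelˡ {x} eq x∉p x∉q = ⊆-antisym (move eq x∉p) (move (sym eq) x∉q)
    where
    move : ∀ {s t} → ⁅ x ⁆ ∪ s ≡ ⁅ x ⁆ ∪ t → x ∉ s → s ⊆ t
    move {s} {t} eq x∉s {y} y∈s with x∈p∪q⁻ ⁅ x ⁆ t (subst (y ∈_) eq (q⊆p∪q ⁅ x ⁆ s y∈s))
    ... | inj₁ y∈⁅x⁆ = contradiction (subst (_∈ s) (x∈⁅y⁆⇒x≡y x y∈⁅x⁆) y∈s) x∉s
    ... | inj₂ y∈t  = y∈t

  ∣p∣≤1+∣p-x∣ : ∀ (p : Subset n) x → ∣ p ∣ ≤ suc ∣ p - x ∣
  ∣p∣≤1+∣p-x∣ p x = begin
    ∣ p ∣                   ≤⟨ p⊆q⇒∣p∣≤∣q∣ (p⊆p-x∪⁅x⁆ p x) ⟩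
    ∣ (p - x) ∪ ⁅ x ⁆ ∣     ≤⟨ ∣p∪q∣≤∣p∣+∣q∣ (p - x) ⁅ x ⁆ ⟩
    ∣ p - x ∣ + ∣ ⁅ x ⁆ ∣   ≡⟨ cong (∣ p - x ∣ +_) (∣⁅x⁆∣≡1 x) ⟩
    ∣ p - x ∣ + 1           ≡⟨ +-comm ∣ p - x ∣ 1 ⟩
    suc ∣ p - x ∣           ∎
    where open ≤-Reasoning

  ∈-setOf⁺ : ∀ {x} (l : List (Fin n)) → x ∈ˡ l → x ∈ setOf l
  ∈-setOf⁺ (y ∷ l) (here refl)  = p⊆p∪q (setOf l) (x∈⁅x⁆ y)
  ∈-setOf⁺ (y ∷ l) (there x∈l) = q⊆p∪q ⁅ y ⁆ (setOf l) (∈-setOf⁺ l x∈l)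

  ∈-setOf⁻ : ∀ {x} (l : List (Fin n)) → x ∈ setOf l → x ∈ˡ l
  ∈-setOf⁻ []      x∈∅ = contradiction x∈∅ ∉⊥
  ∈-setOf⁻ (y ∷ l) x∈y∷l with x∈p∪q⁻ ⁅ y ⁆ (setOf l) x∈y∷l
  ... | inj₁ x∈⁅y⁆ = here (x∈⁅y⁆⇒x≡y y x∈⁅y⁆)
  ... | inj₂ x∈l   = there (∈-setOf⁻ l x∈l)

  setOf-⊆ : ∀ {l} {p : Subset n} → All (_∈ p) l → setOf l ⊆ p
  setOf-⊆ {l} l⊆p x∈l = All.lookup l⊆p (∈-setOf⁻ l x∈l)

  ∉-setOf : ∀ {x} {l : List (Fin n)} → All (x ≢_) l → x ∉ setOf l
  ∉-setOf {l = l} x∉l x∈l = All.lookup x∉l (∈-setOf⁻ l x∈l) refl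

m+n∸o<m⇒n<o : ∀ m n o → m + n ∸ o < m → n < o
m+n∸o<m⇒n<o m n o m+n∸o<m with o ≤? n
... | no  o≰n = ≰⇒> o≰n
... | yes o≤n =
  contradiction (≤-trans (m≤m+n m (n ∸ o)) (≤-reflexive (sym (+-∸-assoc m o≤n)))) (<⇒≱ m+n∸o<m)

m+n∸o≡m⇒o≤n : ∀ m n o → o ≤ m + n → m + n ∸ o ≡ m → o ≤ n
m+n∸o≡m⇒o≤n m n o o≤m+n m+n∸o≡m =
  +-cancelˡ-≤ m o n (≤-reflexive (trans (cong (_+ o) (sym m+n∸o≡m)) (m∸n+n≡m o≤m+n)))

+-≤-tight : ∀ {a b m n} → a ≤ m → b ≤ n → m + n ≤ a + b → a ≡ m × b ≡ n
+-≤-tight {a} {b} {m} {n} a≤m b≤n m+n≤a+b =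
  ≤-antisym a≤m (+-cancelʳ-≤ n m a (≤-trans m+n≤a+b (+-monoʳ-≤ a b≤n))) ,
  ≤-antisym b≤n (+-cancelˡ-≤ m n b (≤-trans m+n≤a+b (+-monoˡ-≤ b a≤m)))

⊓[]≡ : ∀ {n} (rk : Subset n → ℕ) {X Y : Subset n} {k} →
       rk X + rk Y ≡ k + rk (X ∪ Y) → ⊓[ rk ] X Y ≡ k
⊓[]≡ rk {X} {Y} {k} eq = trans (cong (_∸ rk (X ∪ Y)) eq) (m+n∸n≡m k (rk (X ∪ Y)))

-- λ_M(X) + r(M); kept in this form so that no truncated subtraction occurs.
conn : ∀ {n} → Matroid n → Subset n → ℕ
conn M X = r M X + r M (∁ X)

Spans : ∀ {n} → Matroid n → Subset n → Fin n → Set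
Spans M X e = r M (X ∪ ⁅ e ⁆) ≤ r M X

module _ {n : ℕ} (M : Matroid n) where

  r-∪ : ∀ X Y → r M (X ∪ Y) ≤ r M X + r M Y
  r-∪ X Y = ≤-trans (m≤m+n _ _) (r-submod M X Y)

  r-∪⁅x⁆≤ : ∀ X x → r M (X ∪ ⁅ x ⁆) ≤ suc (r M X)
  r-∪⁅x⁆≤ X x = begin
    r M (X ∪ ⁅ x ⁆)     ≤⟨ r-∪ X ⁅ x ⁆ ⟩
    r M X + r M ⁅ x ⁆   ≤⟨ +-monoʳ-≤ (r M X) (subst (r M ⁅ x ⁆ ≤_) (∣⁅x⁆∣≡1 x) (r-bound M ⁅ x ⁆)) ⟩
    r M X + 1           ≡⟨ +-comm (r M X) 1 ⟩
    suc (r M X)         ∎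
    where open ≤-Reasoning

  r≤r-E : ∀ X → r M X ≤ r M E
  r≤r-E X = r-mono M X E ⊆⊤

  r-E≤conn : ∀ X → r M E ≤ conn M X
  r-E≤conn X = begin
    r M E                          ≡⟨ cong (r M) (sym (p∪∁p≡⊤ X)) ⟩
    r M (X ∪ ∁ X)                  ≤⟨ r-∪ X (∁ X) ⟩
    conn M X                       ∎
    where open ≤-Reasoning

  spans-mono : ∀ {W X e} → W ⊆ X → Spans M W e → Spans M X e
  spans-mono {W} {X} {e} W⊆X W-spans = +-cancelʳ-≤ (r M W) _ _ (begin
    r M (X ∪ ⁅ e ⁆) + r M W                    ≤⟨ +-mono-≤ (r-mono M _ _ X∪e⊆) (r-mono M _ _ W⊆) ⟩
    r M (X ∪ W ∪ ⁅ e ⁆) + r M (X ∩ (W ∪ ⁅ e ⁆)) ≤⟨ r-submod M X (W ∪ ⁅ e ⁆) ⟩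
    r M X + r M (W ∪ ⁅ e ⁆)                    ≤⟨ +-monoʳ-≤ (r M X) W-spans ⟩
    r M X + r M W                              ∎)
    where
    open ≤-Reasoning
    X∪e⊆ : X ∪ ⁅ e ⁆ ⊆ X ∪ W ∪ ⁅ e ⁆
    X∪e⊆ = ∪-least (p⊆p∪q (W ∪ ⁅ e ⁆)) (⊆-trans (q⊆p∪q W ⁅ e ⁆) (q⊆p∪q X (W ∪ ⁅ e ⁆)))
    W⊆ : W ⊆ X ∩ (W ∪ ⁅ e ⁆)
    W⊆ x∈W = x∈p∩q⁺ (W⊆X x∈W , p⊆p∪q ⁅ e ⁆ x∈W)

  circuit-spans : ∀ {C W e} → IsCircuit M C → e ∈ C → C ⊆ W ∪ ⁅ e ⁆ → Spans M W e
  circuit-spans {C} {W} {e} (dependent , minimal) e∈C C⊆W∪e = spans-mono C-e⊆W (begin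
    r M ((C - e) ∪ ⁅ e ⁆) ≤⟨ r-mono M _ _ (∪-least (p─q⊆p C ⁅ e ⁆) (x∈p⇒⁅x⁆⊆p e∈C)) ⟩
    r M C               ≤⟨ ≤-pred (≤-trans dependent (∣p∣≤1+∣p-x∣ C e)) ⟩
    ∣ C - e ∣           ≡⟨ minimal (C - e) (x∈p⇒p-x⊂p e∈C) ⟨
    r M (C - e)         ∎)
    where
    open ≤-Reasoning
    C-e⊆W : C - e ⊆ W
    C-e⊆W x∈C-e with x∈p∪q⁻ W ⁅ e ⁆ (C⊆W∪e (p─q⊆p C ⁅ e ⁆ x∈C-e))
    ... | inj₁ x∈W   = x∈W
    ... | inj₂ x∈⁅e⁆ = contradiction x∈⁅e⁆ (x∈p─q⇒x∉q C ⁅ e ⁆ x∈C-e)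

  r-E≤∣X∣+r-∁X : ∀ X → r M E ≤ ∣ X ∣ + r M (∁ X)
  r-E≤∣X∣+r-∁X X = ≤-trans (r-E≤conn X) (+-monoˡ-≤ (r M (∁ X)) (r-bound M X))

  r*+r-E : ∀ X → r* M X + r M E ≡ ∣ X ∣ + r M (∁ X)
  r*+r-E X = m∸n+n≡m (r-E≤∣X∣+r-∁X X)

  cocircuit⇒r-∁<r-E : ∀ {C} → IsCocircuit M C → r M (∁ C) < r M E
  cocircuit⇒r-∁<r-E {C} (dependent , _) = m+n∸o<m⇒n<o ∣ C ∣ (r M (∁ C)) (r M E) dependent

  cocircuit-¬spans : ∀ {C W e} → IsCocircuit M C → e ∈ C → W ⊆ ∁ C → r M W < r M (W ∪ ⁅ e ⁆)
  cocircuit-¬spans {C} {W} {e} cocircuit@(_ , minimal) e∈C W⊆∁C =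
    ≰⇒> (∁C-¬spans ∘ spans-mono W⊆∁C)
    where
    ∁[C-e]-spanning : r M E ≤ r M (∁ (C - e))
    ∁[C-e]-spanning =
      m+n∸o≡m⇒o≤n ∣ C - e ∣ _ _ (r-E≤∣X∣+r-∁X (C - e)) (minimal (C - e) (x∈p⇒p-x⊂p e∈C))
    ∁C-¬spans : ¬ Spans M (∁ C) e
    ∁C-¬spans ∁C-spans = <⇒≱ (cocircuit⇒r-∁<r-E cocircuit)
      (≤-trans ∁[C-e]-spanning (≤-trans (r-mono M _ _ (∁[p-x]⊆∁p∪⁅x⁆ C e)) ∁C-spans))

  conn-∪⁅x⁆≤ : ∀ X x → conn M (X ∪ ⁅ x ⁆) ≤ suc (conn M X)
  conn-∪⁅x⁆≤ X x = +-mono-≤ (r-∪⁅x⁆≤ X x) (r-mono M _ _ (p⊆q⇒∁p⊇∁q (p⊆p∪q ⁅ x ⁆)))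

  spans⇒conn-∪⁅x⁆≤ : ∀ {X e} → Spans M X e → conn M (X ∪ ⁅ e ⁆) ≤ conn M X
  spans⇒conn-∪⁅x⁆≤ X-spans = +-mono-≤ X-spans (r-mono M _ _ (p⊆q⇒∁p⊇∁q (p⊆p∪q _)))

  cospans⇒conn-∪⁅x⁆≤ : ∀ {C X e} → IsCocircuit M C → e ∈ C → C ⊆ X ∪ ⁅ e ⁆ → e ∉ X →
                       conn M (X ∪ ⁅ e ⁆) ≤ conn M X
  cospans⇒conn-∪⁅x⁆≤ {C} {X} {e} cocircuit e∈C C⊆X∪e e∉X = begin
    r M (X ∪ ⁅ e ⁆) + r M ∁[X∪e]      ≤⟨ +-monoˡ-≤ (r M ∁[X∪e]) (r-∪⁅x⁆≤ X e) ⟩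
    suc (r M X + r M ∁[X∪e])          ≡⟨ +-suc (r M X) (r M ∁[X∪e]) ⟨
    r M X + suc (r M ∁[X∪e])          ≤⟨ +-monoʳ-≤ (r M X) e-raises-rank ⟩
    r M X + r M (∁[X∪e] ∪ ⁅ e ⁆)      ≤⟨ +-monoʳ-≤ (r M X) (r-mono M _ _ ∁[X∪e]∪e⊆∁X) ⟩
    r M X + r M (∁ X)                 ∎
    where
    open ≤-Reasoning
    ∁[X∪e] : Subset n
    ∁[X∪e] = ∁ (X ∪ ⁅ e ⁆)
    e-raises-rank : r M ∁[X∪e] < r M (∁[X∪e] ∪ ⁅ e ⁆)
    e-raises-rank = cocircuit-¬spans cocircuit e∈C (p⊆q⇒∁p⊇∁q C⊆X∪e)
    ∁[X∪e]∪e⊆∁X : ∁[X∪e] ∪ ⁅ e ⁆ ⊆ ∁ X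
    ∁[X∪e]∪e⊆∁X = ∪-least (p⊆q⇒∁p⊇∁q (p⊆p∪q ⁅ e ⁆)) (x∈p⇒⁅x⁆⊆p (x∉p⇒x∈∁p e∉X))

  fan-conn≤ : ∀ es → IsFanOrdering M es → conn M (setOf es) ≤ 2 + r M E
  fan-conn≤ []                    (_ , ()                , _)
  fan-conn≤ (_ ∷ [])              (_ , s≤s ()            , _)
  fan-conn≤ (_ ∷ _ ∷ [])          (_ , s≤s (s≤s ())      , _)
  fan-conn≤ (a ∷ b ∷ c ∷ [])      (_ , _ , inj₁ ((dependent , _) , ∣T∣≡3) , _) =
    +-mono-≤ (≤-pred (subst (r M ⟅ a , b , c ⟆ <_) ∣T∣≡3 dependent)) (r≤r-E _)
  fan-conn≤ (a ∷ b ∷ c ∷ [])      (_ , _ , inj₂ (cocircuit , ∣T∣≡3) , _) =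
    ≤-trans (+-monoˡ-≤ _ (subst (r M ⟅ a , b , c ⟆ ≤_) ∣T∣≡3 (r-bound M _)))
            (+-monoʳ-≤ 2 (cocircuit⇒r-∁<r-E cocircuit))
  fan-conn≤ (a ∷ b ∷ c ∷ d ∷ es)
            (distinct , _ , first , triangle⇒triad , triad⇒triangle , alternates) = begin
    conn M (⁅ a ⁆ ∪ S)  ≡⟨ cong (conn M) (∪-comm ⁅ a ⁆ S) ⟩
    conn M (S ∪ ⁅ a ⁆)  ≤⟨ add-a first ⟩
    conn M S            ≤⟨ fan-conn≤ (b ∷ c ∷ d ∷ es)
                           (AllPairs.tail distinct , s≤s (s≤s (s≤s z≤n)) , next first , alternates) ⟩
    2 + r M E           ∎
    where
    open ≤-Reasoning
    S : Subset n
    S = setOf (b ∷ c ∷ d ∷ es)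
    a∈T : a ∈ ⟅ a , b , c ⟆
    a∈T = ∈-setOf⁺ (a ∷ b ∷ c ∷ []) (here refl)
    T⊆S∪a : ⟅ a , b , c ⟆ ⊆ S ∪ ⁅ a ⁆
    T⊆S∪a = setOf-⊆ (x∈p∪⁅x⁆ S a ∷ p⊆p∪q ⁅ a ⁆ (∈-setOf⁺ (b ∷ c ∷ d ∷ es) (here refl)) ∷
                     p⊆p∪q ⁅ a ⁆ (∈-setOf⁺ (b ∷ c ∷ d ∷ es) (there (here refl))) ∷ [])
    add-a : FirstTriple M (a ∷ b ∷ c ∷ d ∷ es) → conn M (S ∪ ⁅ a ⁆) ≤ conn M S
    add-a (inj₁ (circuit , _))   = spans⇒conn-∪⁅x⁆≤ (circuit-spans circuit a∈T T⊆S∪a)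
    add-a (inj₂ (cocircuit , _)) =
      cospans⇒conn-∪⁅x⁆≤ cocircuit a∈T T⊆S∪a (∉-setOf (AllPairs.head distinct))
    next : FirstTriple M (a ∷ b ∷ c ∷ d ∷ es) → FirstTriple M (b ∷ c ∷ d ∷ es)
    next (inj₁ triangle) = inj₂ (triangle⇒triad triangle)
    next (inj₂ triad)    = inj₁ (triad⇒triangle triad)

  3-connected⇒2+r-E≤conn : ThreeConnected M → ∀ X → 2 ≤ ∣ X ∣ → 2 ≤ ∣ ∁ X ∣ → 2 + r M E ≤ conn M X
  3-connected⇒2+r-E≤conn 3-connected X 2≤∣X∣ 2≤∣∁X∣ = ≮⇒≥ (3-connected X 2 ≤-refl 2≤∣X∣ 2≤∣∁X∣)

  3-connected⇒pair : ∀ {x y} → ThreeConnected M → x ≢ y → 2 ≤ ∣ ∁ (⁅ x ⁆ ∪ ⁅ y ⁆) ∣ →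
                     r M (⁅ x ⁆ ∪ ⁅ y ⁆) ≡ 2 × r M (∁ (⁅ x ⁆ ∪ ⁅ y ⁆)) ≡ r M E
  3-connected⇒pair {x} {y} 3-connected x≢y 2≤∣∁P∣ = +-≤-tight
    (subst (r M P ≤_) (∣⁅x⁆∪⁅y⁆∣≡2 x≢y) (r-bound M P))
    (r≤r-E (∁ P))
    (3-connected⇒2+r-E≤conn 3-connected P (≤-reflexive (sym (∣⁅x⁆∪⁅y⁆∣≡2 x≢y))) 2≤∣∁P∣)
    where
    P : Subset n
    P = ⁅ x ⁆ ∪ ⁅ y ⁆

module LeftFanTypeEnd
  {n : ℕ} (M : Matroid n) (3-connected : ThreeConnected M)
  {G F H : Subset n}
  (G∩F≡∅ : Disjoint G F) (G∩H≡∅ : Disjoint G H) (F∩H≡∅ : Disjoint F H) (G∪F∪H≡E : G ∪ (F ∪ H) ≡ E)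
  (2≤∣H∣ : 2 ≤ ∣ H ∣) (conn-F≤ : conn M F ≤ 2 + r M E)
  {e₁ e₂ g₂ g₃ g₄ g₅ : Fin n} (e₁∈F : e₁ ∈ F) (e₂∈F : e₂ ∈ F)
  (G≡ : G ≡ setOf (g₂ ∷ g₃ ∷ g₄ ∷ g₅ ∷ [])) (distinct : Unique (g₂ ∷ g₃ ∷ g₄ ∷ g₅ ∷ []))
  (triangle₁ : IsTriangle M ⟅ e₁ , g₂ , g₃ ⟆)
  (triad : IsTriad M ⟅ g₂ , g₃ , g₄ ⟆)
  (triangle₂ : IsTriangle M ⟅ g₃ , g₄ , g₅ ⟆)
  (cocircuit : IsCocircuit M (setOf (e₁ ∷ e₂ ∷ g₃ ∷ g₅ ∷ [])))
  where

  private
    gs : List (Fin n)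
    gs = g₂ ∷ g₃ ∷ g₄ ∷ g₅ ∷ []

    g₂≢g₃ : g₂ ≢ g₃
    g₂≢g₃ = All.lookup (AllPairs.head distinct) (here refl)
    g₂≢g₄ : g₂ ≢ g₄
    g₂≢g₄ = All.lookup (AllPairs.head distinct) (there (here refl))
    g₂≢g₅ : g₂ ≢ g₅
    g₂≢g₅ = All.lookup (AllPairs.head distinct) (there (there (here refl)))
    g₃≢g₄ : g₃ ≢ g₄
    g₃≢g₄ = All.lookup (AllPairs.head (AllPairs.tail distinct)) (here refl)
    g₃≢g₅ : g₃ ≢ g₅
    g₃≢g₅ = All.lookup (AllPairs.head (AllPairs.tail distinct)) (there (here refl))
    g₄≢g₅ : g₄ ≢ g₅
    g₄≢g₅ = All.lookup (AllPairs.head (AllPairs.tail (AllPairs.tail distinct))) (here refl)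

    ∈G : ∀ {x} → x ∈ˡ gs → x ∈ G
    ∈G x∈gs = subst (_ ∈_) (sym G≡) (∈-setOf⁺ gs x∈gs)

    ∈G⇒∉F : ∀ {x} → x ∈ G → x ∉ F
    ∈G⇒∉F = disjoint⁻ G∩F≡∅

    ∈G⇒∈∁H : ∀ {x} → x ∈ G → x ∈ ∁ H
    ∈G⇒∈∁H = x∉p⇒x∈∁p ∘ disjoint⁻ G∩H≡∅

    F⊆∁H : F ⊆ ∁ H
    F⊆∁H = x∉p⇒x∈∁p ∘ disjoint⁻ F∩H≡∅

    g₂∈G : g₂ ∈ G
    g₂∈G = ∈G (here refl)
    g₃∈G : g₃ ∈ G
    g₃∈G = ∈G (there (here refl))
    g₄∈G : g₄ ∈ G
    g₄∈G = ∈G (there (there (here refl)))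
    g₅∈G : g₅ ∈ G
    g₅∈G = ∈G (there (there (there (here refl))))

    g₂∈∁H : g₂ ∈ ∁ H
    g₂∈∁H = ∈G⇒∈∁H g₂∈G
    g₃∈∁H : g₃ ∈ ∁ H
    g₃∈∁H = ∈G⇒∈∁H g₃∈G
    g₄∈∁H : g₄ ∈ ∁ H
    g₄∈∁H = ∈G⇒∈∁H g₄∈G
    g₅∈∁H : g₅ ∈ ∁ H
    g₅∈∁H = ∈G⇒∈∁H g₅∈G

    ∁H⊆ : ∀ {Z} → F ⊆ Z → All (_∈ Z) gs → ∁ H ⊆ Z
    ∁H⊆ {Z} F⊆Z gs⊆Z {x} x∈∁H with x∈p∪q⁻ G (F ∪ H) (subst (x ∈_) (sym G∪F∪H≡E) ∈⊤)
    ... | inj₁ x∈G = subst (_⊆ Z) (sym G≡) (setOf-⊆ gs⊆Z) x∈G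
    ... | inj₂ x∈F∪H with x∈p∪q⁻ F H x∈F∪H
    ...   | inj₁ x∈F = F⊆Z x∈F
    ...   | inj₂ x∈H = contradiction x∈H (x∈∁p⇒x∉p x∈∁H)

    2+r-E≤conn-H : 2 + r M E ≤ conn M H
    2+r-E≤conn-H = 3-connected⇒2+r-E≤conn M 3-connected H 2≤∣H∣ (2≤∣p∣ g₂≢g₃ g₂∈∁H g₃∈∁H)

    g₂-spanned : ∀ {W} → e₁ ∈ W → g₃ ∈ W → Spans M W g₂
    g₂-spanned {W} e₁∈W g₃∈W =
      circuit-spans M (proj₁ triangle₁) (∈-setOf⁺ (e₁ ∷ g₂ ∷ g₃ ∷ []) (there (here refl)))
      (setOf-⊆ (p⊆p∪q _ e₁∈W ∷ x∈p∪⁅x⁆ W g₂ ∷ p⊆p∪q _ g₃∈W ∷ []))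

    g₄-spanned : ∀ {W} → g₃ ∈ W → g₅ ∈ W → Spans M W g₄
    g₄-spanned {W} g₃∈W g₅∈W =
      circuit-spans M (proj₁ triangle₂) (∈-setOf⁺ (g₃ ∷ g₄ ∷ g₅ ∷ []) (there (here refl)))
      (setOf-⊆ (p⊆p∪q _ g₃∈W ∷ x∈p∪⁅x⁆ W g₄ ∷ p⊆p∪q _ g₅∈W ∷ []))

    g₅-spanned : ∀ {W} → g₃ ∈ W → g₄ ∈ W → Spans M W g₅
    g₅-spanned {W} g₃∈W g₄∈W =
      circuit-spans M (proj₁ triangle₂) (∈-setOf⁺ (g₃ ∷ g₄ ∷ g₅ ∷ []) (there (there (here refl))))
      (setOf-⊆ (p⊆p∪q _ g₃∈W ∷ p⊆p∪q _ g₄∈W ∷ x∈p∪⁅x⁆ W g₅ ∷ []))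

    g₄-¬spanned : ∀ {W} → g₂ ∉ W → g₃ ∉ W → g₄ ∉ W → r M W < r M (W ∪ ⁅ g₄ ⁆)
    g₄-¬spanned g₂∉W g₃∉W g₄∉W =
      cocircuit-¬spans M (proj₁ triad) (∈-setOf⁺ (g₂ ∷ g₃ ∷ g₄ ∷ []) (there (there (here refl))))
      (p⊆∁q⇒q⊆∁p (setOf-⊆ (x∉p⇒x∈∁p g₂∉W ∷ x∉p⇒x∈∁p g₃∉W ∷ x∉p⇒x∈∁p g₄∉W ∷ [])))

    g₅-¬spanned : ∀ {W} → e₁ ∉ W → e₂ ∉ W → g₃ ∉ W → g₅ ∉ W → r M W < r M (W ∪ ⁅ g₅ ⁆)
    g₅-¬spanned e₁∉W e₂∉W g₃∉W g₅∉W =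
      cocircuit-¬spans M cocircuit (∈-setOf⁺ (e₁ ∷ e₂ ∷ g₃ ∷ g₅ ∷ []) (there (there (there (here refl)))))
      (p⊆∁q⇒q⊆∁p (setOf-⊆ (x∉p⇒x∈∁p e₁∉W ∷ x∉p⇒x∈∁p e₂∉W ∷ x∉p⇒x∈∁p g₃∉W ∷ x∉p⇒x∈∁p g₅∉W ∷ [])))

    g₃-cospanned : ∀ {X} → e₁ ∈ X → e₂ ∈ X → g₅ ∈ X → g₃ ∉ X → conn M (X ∪ ⁅ g₃ ⁆) ≤ conn M X
    g₃-cospanned {X} e₁∈X e₂∈X g₅∈X =
      cospans⇒conn-∪⁅x⁆≤ M cocircuit (∈-setOf⁺ (e₁ ∷ e₂ ∷ g₃ ∷ g₅ ∷ []) (there (there (here refl))))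
      (setOf-⊆ (p⊆p∪q _ e₁∈X ∷ p⊆p∪q _ e₂∈X ∷ x∈p∪⁅x⁆ X g₃ ∷ p⊆p∪q _ g₅∈X ∷ []))

    A X₂ : Subset n
    A  = ⁅ g₂ ⁆ ∪ ⁅ g₄ ⁆
    X₂ = (F ∪ ⁅ g₅ ⁆) ∪ ⁅ g₃ ⁆

    g∈∁X₂ : ∀ {x} → x ∈ G → x ≢ g₅ → x ≢ g₃ → x ∈ ∁ X₂
    g∈∁X₂ x∈G x≢g₅ x≢g₃ = x∉p⇒x∈∁p (x∉p∪q⁺ (x∉p∪q⁺ (∈G⇒∉F x∈G) (x≢y⇒x∉⁅y⁆ x≢g₅)) (x≢y⇒x∉⁅y⁆ x≢g₃))

    A∪H⊆∁X₂ : A ∪ H ⊆ ∁ X₂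
    A∪H⊆∁X₂ = ∪-least
      (∪-least (x∈p⇒⁅x⁆⊆p (g∈∁X₂ g₂∈G g₂≢g₅ g₂≢g₃))
               (x∈p⇒⁅x⁆⊆p (g∈∁X₂ g₄∈G g₄≢g₅ (≢-sym g₃≢g₄))))
      (p⊆∁q⇒q⊆∁p (∪-least (∪-least F⊆∁H (x∈p⇒⁅x⁆⊆p g₅∈∁H)) (x∈p⇒⁅x⁆⊆p g₃∈∁H)))

    conn-X₂≤ : conn M X₂ ≤ 3 + r M E
    conn-X₂≤ = ≤-trans
      (g₃-cospanned (p⊆p∪q _ e₁∈F) (p⊆p∪q _ e₂∈F) (x∈p∪⁅x⁆ F g₅)
                    (x∉p∪q⁺ (∈G⇒∉F g₃∈G) (x≢y⇒x∉⁅y⁆ g₃≢g₅)))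
      (≤-trans (conn-∪⁅x⁆≤ M F g₅) (s≤s conn-F≤))

    r-∁H≤r-X₂ : r M (∁ H) ≤ r M X₂
    r-∁H≤r-X₂ = begin
      r M (∁ H)                       ≤⟨ r-mono M _ _ ∁H⊆X₂∪A ⟩
      r M ((X₂ ∪ ⁅ g₂ ⁆) ∪ ⁅ g₄ ⁆)    ≤⟨ g₄-spanned (p⊆p∪q _ g₃∈X₂) (p⊆p∪q _ g₅∈X₂) ⟩
      r M (X₂ ∪ ⁅ g₂ ⁆)               ≤⟨ g₂-spanned (p⊆p∪q _ (p⊆p∪q _ e₁∈F)) g₃∈X₂ ⟩
      r M X₂                          ∎
      where
      open ≤-Reasoning
      g₃∈X₂ : g₃ ∈ X₂
      g₃∈X₂ = x∈p∪⁅x⁆ _ g₃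
      g₅∈X₂ : g₅ ∈ X₂
      g₅∈X₂ = p⊆p∪q _ (x∈p∪⁅x⁆ F g₅)
      ∁H⊆X₂∪A : ∁ H ⊆ (X₂ ∪ ⁅ g₂ ⁆) ∪ ⁅ g₄ ⁆
      ∁H⊆X₂∪A = ∁H⊆ (p⊆p∪q _ ∘ p⊆p∪q _ ∘ p⊆p∪q _ ∘ p⊆p∪q _)
        (p⊆p∪q _ (x∈p∪⁅x⁆ X₂ g₂) ∷ p⊆p∪q _ (p⊆p∪q _ g₃∈X₂) ∷ x∈p∪⁅x⁆ _ g₄ ∷ p⊆p∪q _ (p⊆p∪q _ g₅∈X₂) ∷ [])

    r-A∪H≡ : r M (A ∪ H) ≡ suc (r M H)
    r-A∪H≡ = ≤-antisym upper lower
      where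
      open ≤-Reasoning
      g₄∈A : g₄ ∈ A
      g₄∈A = x∈p∪⁅x⁆ ⁅ g₂ ⁆ g₄
      lower : suc (r M H) ≤ r M (A ∪ H)
      lower = begin
        suc (r M H)          ≤⟨ g₄-¬spanned (x∈∁p⇒x∉p g₂∈∁H) (x∈∁p⇒x∉p g₃∈∁H) (x∈∁p⇒x∉p g₄∈∁H) ⟩
        r M (H ∪ ⁅ g₄ ⁆)     ≤⟨ r-mono M _ _ (∪-least (q⊆p∪q A H) (x∈p⇒⁅x⁆⊆p (p⊆p∪q H g₄∈A))) ⟩
        r M (A ∪ H)          ∎
      upper : r M (A ∪ H) ≤ suc (r M H)
      upper = +-cancelʳ-≤ (r M (∁ H)) _ _ (begin
        r M (A ∪ H) + r M (∁ H)   ≤⟨ +-mono-≤ (r-mono M _ _ A∪H⊆∁X₂) r-∁H≤r-X₂ ⟩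
        r M (∁ X₂) + r M X₂       ≡⟨ +-comm (r M (∁ X₂)) (r M X₂) ⟩
        conn M X₂                 ≤⟨ conn-X₂≤ ⟩
        3 + r M E                 ≤⟨ s≤s 2+r-E≤conn-H ⟩
        suc (r M H) + r M (∁ H)   ∎)

    r-A≡2 : r M A ≡ 2
    r-A≡2 = proj₁ (3-connected⇒pair M 3-connected g₂≢g₄ (2≤∣p∣ g₃≢g₅ g₃∈∁A g₅∈∁A))
      where
      g₃∈∁A : g₃ ∈ ∁ A
      g₃∈∁A = x∉p⇒x∈∁p (x∉p∪q⁺ (x≢y⇒x∉⁅y⁆ (≢-sym g₂≢g₃)) (x≢y⇒x∉⁅y⁆ g₃≢g₄))
      g₅∈∁A : g₅ ∈ ∁ A
      g₅∈∁A = x∉p⇒x∈∁p (x∉p∪q⁺ (x≢y⇒x∉⁅y⁆ (≢-sym g₂≢g₅)) (x≢y⇒x∉⁅y⁆ (≢-sym g₄≢g₅)))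

  ⊓-g₂g₄-H : ⊓ M (⁅ g₂ ⁆ ∪ ⁅ g₄ ⁆) H ≡ 1
  ⊓-g₂g₄-H = ⊓[]≡ (r M) (trans (cong (_+ r M H) r-A≡2) (cong suc (sym r-A∪H≡)))

  private
    B X₄ D : Subset n
    B  = ⁅ g₄ ⁆ ∪ ⁅ g₅ ⁆
    X₄ = (F ∪ ⁅ g₃ ⁆) ∪ ⁅ g₂ ⁆
    D  = ∁ (B ∪ H)

    g∈∁X₄ : ∀ {x} → x ∈ G → x ≢ g₃ → x ≢ g₂ → x ∈ ∁ X₄
    g∈∁X₄ x∈G x≢g₃ x≢g₂ = x∉p⇒x∈∁p (x∉p∪q⁺ (x∉p∪q⁺ (∈G⇒∉F x∈G) (x≢y⇒x∉⁅y⁆ x≢g₃)) (x≢y⇒x∉⁅y⁆ x≢g₂))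

    conn-X₄≤ : conn M X₄ ≤ 3 + r M E
    conn-X₄≤ = ≤-trans
      (spans⇒conn-∪⁅x⁆≤ M (g₂-spanned (p⊆p∪q _ e₁∈F) (x∈p∪⁅x⁆ F g₃)))
      (≤-trans (conn-∪⁅x⁆≤ M F g₃) (s≤s conn-F≤))

    D⊆X₄ : D ⊆ X₄
    D⊆X₄ = ∁q⊆r∪p⇒∁[p∪q]⊆r (∁H⊆ (p⊆p∪q _ ∘ p⊆p∪q _ ∘ p⊆p∪q _)
      (p⊆p∪q _ (x∈p∪⁅x⁆ _ g₂) ∷ p⊆p∪q _ (p⊆p∪q _ (x∈p∪⁅x⁆ F g₃)) ∷
       q⊆p∪q X₄ B (p⊆p∪q _ (x∈⁅x⁆ g₄)) ∷ q⊆p∪q X₄ B (x∈p∪⁅x⁆ _ g₅) ∷ []))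

    2+r-H≤r-∁X₄ : 2 + r M H ≤ r M (∁ X₄)
    2+r-H≤r-∁X₄ = begin
      2 + r M H                        ≤⟨ s≤s (g₅-¬spanned (x∈∁p⇒x∉p (F⊆∁H e₁∈F)) (x∈∁p⇒x∉p (F⊆∁H e₂∈F))
                                                         (x∈∁p⇒x∉p g₃∈∁H) (x∈∁p⇒x∉p g₅∈∁H)) ⟩
      suc (r M (H ∪ ⁅ g₅ ⁆))           ≤⟨ g₄-¬spanned (x∉p∪q⁺ (x∈∁p⇒x∉p g₂∈∁H) (x≢y⇒x∉⁅y⁆ g₂≢g₅))
                                                     (x∉p∪q⁺ (x∈∁p⇒x∉p g₃∈∁H) (x≢y⇒x∉⁅y⁆ g₃≢g₅))
                                                     (x∉p∪q⁺ (x∈∁p⇒x∉p g₄∈∁H) (x≢y⇒x∉⁅y⁆ g₄≢g₅)) ⟩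
      r M ((H ∪ ⁅ g₅ ⁆) ∪ ⁅ g₄ ⁆)      ≤⟨ r-mono M _ _ [H∪g₅]∪g₄⊆∁X₄ ⟩
      r M (∁ X₄)                       ∎
      where
      open ≤-Reasoning
      [H∪g₅]∪g₄⊆∁X₄ : (H ∪ ⁅ g₅ ⁆) ∪ ⁅ g₄ ⁆ ⊆ ∁ X₄
      [H∪g₅]∪g₄⊆∁X₄ = ∪-least
        (∪-least (p⊆∁q⇒q⊆∁p (∪-least (∪-least F⊆∁H (x∈p⇒⁅x⁆⊆p g₃∈∁H)) (x∈p⇒⁅x⁆⊆p g₂∈∁H)))
                 (x∈p⇒⁅x⁆⊆p (g∈∁X₄ g₅∈G (≢-sym g₃≢g₅) (≢-sym g₂≢g₅))))
        (x∈p⇒⁅x⁆⊆p (g∈∁X₄ g₄∈G (≢-sym g₃≢g₄) (≢-sym g₂≢g₄)))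

    r-∁H≡ : r M (∁ H) ≡ suc (r M D)
    r-∁H≡ = ≤-antisym upper lower
      where
      open ≤-Reasoning
      g₃∈D : g₃ ∈ D
      g₃∈D = x∉p⇒x∈∁p (x∉p∪q⁺ (x∉p∪q⁺ (x≢y⇒x∉⁅y⁆ g₃≢g₄) (x≢y⇒x∉⁅y⁆ g₃≢g₅)) (x∈∁p⇒x∉p g₃∈∁H))
      upper : r M (∁ H) ≤ suc (r M D)
      upper = begin
        r M (∁ H)                    ≤⟨ r-mono M _ _ (∁q⊆∁[p∪q]∪p B H) ⟩
        r M (D ∪ B)                  ≡⟨ cong (r M) (∪-assoc D ⁅ g₄ ⁆ ⁅ g₅ ⁆) ⟨
        r M ((D ∪ ⁅ g₄ ⁆) ∪ ⁅ g₅ ⁆)  ≤⟨ g₅-spanned (p⊆p∪q _ g₃∈D) (x∈p∪⁅x⁆ D g₄) ⟩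
        r M (D ∪ ⁅ g₄ ⁆)             ≤⟨ r-∪⁅x⁆≤ M D g₄ ⟩
        suc (r M D)                  ∎
      lower : suc (r M D) ≤ r M (∁ H)
      lower = +-cancelʳ-≤ (r M H) _ _ (≤-pred (begin
        suc (suc (r M D) + r M H)    ≡⟨ cong suc (+-suc (r M D) (r M H)) ⟨
        suc (r M D + suc (r M H))    ≡⟨ +-suc (r M D) (suc (r M H)) ⟨
        r M D + (2 + r M H)          ≤⟨ +-mono-≤ (r-mono M _ _ D⊆X₄) 2+r-H≤r-∁X₄ ⟩
        conn M X₄                    ≤⟨ conn-X₄≤ ⟩
        3 + r M E                    ≤⟨ s≤s 2+r-E≤conn-H ⟩
        suc (r M H + r M (∁ H))      ≡⟨ cong suc (+-comm (r M H) (r M (∁ H))) ⟩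
        suc (r M (∁ H) + r M H)      ∎))

    r*-B∪H≡ : r* M (B ∪ H) ≡ suc (r* M H)
    r*-B∪H≡ = +-cancelʳ-≡ (r M E) _ _ (begin
      r* M (B ∪ H) + r M E         ≡⟨ r*+r-E M (B ∪ H) ⟩
      ∣ B ∪ H ∣ + r M D            ≡⟨ cong (_+ r M D) (∣p∪q∣≡∣p∣+∣q∣ B H B∩H≡∅) ⟩
      ∣ B ∣ + ∣ H ∣ + r M D        ≡⟨ cong (λ b → b + ∣ H ∣ + r M D) (∣⁅x⁆∪⁅y⁆∣≡2 g₄≢g₅) ⟩
      suc (suc (∣ H ∣ + r M D))    ≡⟨ cong suc (+-suc ∣ H ∣ (r M D)) ⟨
      suc (∣ H ∣ + suc (r M D))    ≡⟨ cong (λ c → suc (∣ H ∣ + c)) r-∁H≡ ⟨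
      suc (∣ H ∣ + r M (∁ H))      ≡⟨ cong suc (r*+r-E M H) ⟨
      suc (r* M H) + r M E         ∎)
      where
      open ≡-Reasoning
      B∩H≡∅ : Disjoint B H
      B∩H≡∅ = disjoint⁺ (x∈∁p⇒x∉p ∘ ∪-least (x∈p⇒⁅x⁆⊆p g₄∈∁H) (x∈p⇒⁅x⁆⊆p g₅∈∁H))

    r*-B≡2 : r* M B ≡ 2
    r*-B≡2 = +-cancelʳ-≡ (r M E) _ _ (begin
      r* M B + r M E        ≡⟨ r*+r-E M B ⟩
      ∣ B ∣ + r M (∁ B)     ≡⟨ cong₂ _+_ (∣⁅x⁆∪⁅y⁆∣≡2 g₄≢g₅) r-∁B≡r-E ⟩
      2 + r M E             ∎)
      where
      open ≡-Reasoning
      g₂∈∁B : g₂ ∈ ∁ B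
      g₂∈∁B = x∉p⇒x∈∁p (x∉p∪q⁺ (x≢y⇒x∉⁅y⁆ g₂≢g₄) (x≢y⇒x∉⁅y⁆ g₂≢g₅))
      g₃∈∁B : g₃ ∈ ∁ B
      g₃∈∁B = x∉p⇒x∈∁p (x∉p∪q⁺ (x≢y⇒x∉⁅y⁆ g₃≢g₄) (x≢y⇒x∉⁅y⁆ g₃≢g₅))
      r-∁B≡r-E : r M (∁ B) ≡ r M E
      r-∁B≡r-E = proj₂ (3-connected⇒pair M 3-connected g₄≢g₅ (2≤∣p∣ g₂≢g₃ g₂∈∁B g₃∈∁B))

  ⊓*-g₄g₅-H : ⊓* M (⁅ g₄ ⁆ ∪ ⁅ g₅ ⁆) H ≡ 1
  ⊓*-g₄g₅-H = ⊓[]≡ (r* M) (trans (cong (_+ r* M H) r*-B≡2) (cong suc (sym r*-B∪H≡)))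

lemma2p1 : ∀ {n k : ℕ} (M : Matroid n) (G F H : Subset n)
             (es : Vec (Fin n) (suc (suc k))) (g₂ g₃ g₄ g₅ : Fin n) →
           IsAccordionWith M G F H es →
           LeftFanTypeEndWith M F (e-1 es) (e-2 es) G g₂ g₃ g₄ g₅ →
           (⊓ M (⁅ g₂ ⁆ ∪ ⁅ g₄ ⁆) H ≡ 1) × (⊓* M (⁅ g₄ ⁆ ∪ ⁅ g₅ ⁆) H ≡ 1)
lemma2p1 M G F H es@(e₁ ∷ e₂ ∷ _) g₂ g₃ g₄ g₅
  (3-connected , (G∩F≡∅ , G∩H≡∅ , F∩H≡∅ , G∪F∪H≡E) , (_ , F-fan , F≡ , _) , _)
  ((_ , ∣G∪F∣+2≤n) , _ , _ , (e₁∉gs ∷ distinct , _ , _ , triangle⇒triad , _ , _ , triad⇒triangle , _) ,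
   G∪e₁≡ , triangle₁ , cocircuit) =
  ⊓-g₂g₄-H , ⊓*-g₄g₅-H
  where
  e₁∈F : e₁ ∈ F
  e₁∈F = subst (e₁ ∈_) F≡ (∈-setOf⁺ (toList es) (here refl))
  e₂∈F : e₂ ∈ F
  e₂∈F = subst (e₂ ∈_) F≡ (∈-setOf⁺ (toList es) (there (here refl)))
  G≡ : G ≡ setOf (g₂ ∷ g₃ ∷ g₄ ∷ g₅ ∷ [])
  G≡ = ⁅⁆-∪-cancelˡ (trans (∪-comm ⁅ e₁ ⁆ G) (sym G∪e₁≡))
                    (λ e₁∈G → disjoint⁻ G∩F≡∅ e₁∈G e₁∈F) (∉-setOf e₁∉gs)
  2≤∣H∣ : 2 ≤ ∣ H ∣
  2≤∣H∣ = +-cancelˡ-≤ (∣ G ∪ F ∣) 2 (∣ H ∣)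
            (≤-trans ∣G∪F∣+2≤n (∪≡⊤⇒n≤∣p∣+∣q∣ (trans (∪-assoc G F H) G∪F∪H≡E)))
  conn-F≤ : conn M F ≤ 2 + r M E
  conn-F≤ = subst (λ X → conn M X ≤ 2 + r M E) F≡ (fan-conn≤ M (toList es) F-fan)
  triad : IsTriad M ⟅ g₂ , g₃ , g₄ ⟆
  triad = triangle⇒triad triangle₁
  open LeftFanTypeEnd M 3-connected G∩F≡∅ G∩H≡∅ F∩H≡∅ G∪F∪H≡E 2≤∣H∣ conn-F≤ e₁∈F e₂∈F G≡ distinct
         triangle₁ triad (triad⇒triangle triad) cocircuit
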